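{- Let $t\leq m$ be positive integers and $(\mathbb{F}_{2^m},+,\star)$ a left pre-quasifield. Let $\tau:\mathbb{F}_{2^m}\to\mathbb{F}_{2^t}$ be surjective and $\mathbb{F}_2$-linear, $\sigma:\mathbb{F}_{2^m}\to\mathbb{F}_{2^m}$ invertible, and $h:\mathbb{F}_{2^m}\to\mathbb{F}_{2^t}$ arbitrary. Then \[ f(x,y)=\tau\big(\sigma(y)\star x\big)+h(y),\qquad x,y\in\mathbb{F}_{2^m}, \] is a $(2m,t)$-bent function.
   Context: A left pre-quasifield is a triple $(Q,+,\star)$ where $(Q,+)$ is a finite abelian group (here the additive group of $\mathbb{F}_{2^m}$) and $\star:Q\times Q\to Q$ satisfies: (1) $x\star 0=0\star x=0$; (2) $x\star(y+z)=x\star y+x\star z$; (3) for every $a\neq 0$ the maps $x\mapsto x\star a$ and $x\mapsto a\star x$ are bijective. Identifying the domain with $\mathbb{F}_2^{n}$ ($n=2m$) and codomain with $\mathbb{F}_2^t$, an $(n,t)$-function $F$ is $(n,t)$-bent if every component function $x\mapsto v\cdot F(x)$, $v\in\mathbb{F}_2^t\setminus\{0\}$, is a bent Boolean function, i.e. $\sum_x(-1)^{v\cdot F(x)+a\cdot x}=\pm2^{n/2}$ for all $a\in\mathbb{F}_2^n$ and all $v\neq0$. -}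

module Defs where

open import Data.Bool using (Bool; true; false; _xor_; _∧_; if_then_else_)
open import Data.Nat using (ℕ; zero; suc; _^_)
open import Data.Integer using (ℤ; +_; -_; _+_)
open import Data.Vec using (Vec; []; _∷_; zipWith; replicate; foldr)
open import Data.List using (List; []; _∷_; map; concatMap; _++_)
open import Data.Product using (_×_; _,_; ∃)
open import Data.Sum using (_⊎_)
open import Function.Definitions using (Bijective; Surjective)
open import Relation.Binary.PropositionalEquality using (_≡_)
open import Relation.Nullary using (¬_)

-- F_2^n, used as the additive group of F_{2^n}
Bits : ℕ → Set
Bits n = Vec Bool n

_⊕_ : ∀ {n} → Bits n → Bits n → Bits n
_⊕_ = zipWith _xor_
infixl 6 _⊕_

𝟘 : ∀ {n} → Bits n
𝟘 = replicate _ false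

_·_ : ∀ {n} → Bits n → Bits n → Bool
u · w = foldr _ _xor_ false (zipWith _∧_ u w)
infix 7 _·_

allBits : (n : ℕ) → List (Bits n)
allBits zero = [] ∷ []
allBits (suc n) = map (false ∷_) (allBits n) ++ map (true ∷_) (allBits n)

sgn : Bool → ℤ
sgn false = + 1
sgn true  = - (+ 1)

sumL : ∀ {A : Set} → (A → ℤ) → List A → ℤ
sumL f [] = + 0
sumL f (x ∷ xs) = f x + sumL f xs

record IsLeftPreQuasifield {m : ℕ} (_⋆_ : Bits m → Bits m → Bits m) : Set where
  field
    zeroʳ : ∀ x → x ⋆ 𝟘 ≡ 𝟘
    zeroˡ : ∀ x → 𝟘 ⋆ x ≡ 𝟘
    distribˡ : ∀ x y z → x ⋆ (y ⊕ z) ≡ (x ⋆ y) ⊕ (x ⋆ z)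
    bijʳ : ∀ a → ¬ (a ≡ 𝟘) → Bijective _≡_ _≡_ (λ x → x ⋆ a)
    bijˡ : ∀ a → ¬ (a ≡ 𝟘) → Bijective _≡_ _≡_ (λ x → a ⋆ x)

-- F_2-linear map (over F_2, additivity is F_2-linearity)
IsF2Linear : ∀ {m t} → (Bits m → Bits t) → Set
IsF2Linear τ = ∀ x y → τ (x ⊕ y) ≡ τ x ⊕ τ y

-- Walsh transform of component v·F at a = (a₁,a₂), for F : F_2^m × F_2^m → F_2^t,
-- identifying F_2^{2m} with F_2^m × F_2^m, a·(x,y) = a₁·x + a₂·y.
walsh : ∀ {m t} → (Bits m → Bits m → Bits t) → Bits t → Bits m → Bits m → ℤ
walsh {m} F v a₁ a₂ =
  sumL (λ x → sumL (λ y → sgn ((v · F x y) xor (a₁ · x) xor (a₂ · y))) (allBits m)) (allBits m)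

IsBent : ∀ {m t} → (Bits m → Bits m → Bits t) → Set
IsBent {m} {t} F = ∀ (v : Bits t) → ¬ (v ≡ 𝟘) → ∀ (a₁ a₂ : Bits m) →
  (walsh F v a₁ a₂ ≡ + (2 ^ m)) ⊎ (walsh F v a₁ a₂ ≡ - (+ (2 ^ m)))

-- Put φ = v · τ, a nonzero F₂-linear functional on F_{2^m}. For fixed b the map
-- x ↦ φ (b ⋆ x) + a₁ · x is linear, so its sign sum Z b is 0 or 2^m. Summing Z b over
-- all b and exchanging the sums gives 2^m, because for x ≠ 0 the map b ↦ b ⋆ x is a
-- bijection and φ is balanced. Hence Z is 2^m at exactly one b, and since σ is a
-- bijection the Walsh value Σ_y (-1)^(v · h y + a₂ · y) Z (σ y) is ±2^m.
module Submission where

open import Defs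
open import Data.Nat using (ℕ; _≤_; _^_)
open import Function.Definitions using (Bijective; Surjective)
open import Relation.Binary.PropositionalEquality using (_≡_)

open import Algebra.Bundles using (CommutativeRing)
open import Data.Bool using (Bool; true; false; _xor_; if_then_else_)
open import Data.Bool.Properties using (xor-∧-commutativeRing; xor-same; xor-assoc; xor-identityʳ)
  renaming (_≟_ to _≟ᵇ_)
open import Data.Integer using (ℤ; +_; -_; _+_; _*_; 0ℤ; 1ℤ; -1ℤ)
open import Data.Integer.Properties
  using (+-commutativeSemigroup; +-identityˡ; +-identityʳ; +-assoc; +-injective;
         *-identityˡ; *-identityʳ; *-assoc; *-comm; *-distribʳ-+; neg-distrib-+; -1*i≡-i)
import Data.Nat as ℕ
import Data.Nat.Properties as ℕ
open import Data.List using (List; []; _∷_; map; _++_)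
open import Data.Product using (∃; _,_; proj₁; proj₂)
open import Data.Sum using (_⊎_; inj₁; inj₂; [_,_]′)
  renaming (map to map-⊎)
open import Data.Vec using ([]; _∷_)
open import Data.Vec.Properties using (≡-dec; zipWith-assoc; zipWith-identityʳ)
open import Data.Empty using (⊥-elim)
open import Function using (_∘_)
open import Function.Bundles using (Inverse; mk⤖)
open import Function.Properties.Bijection using (⤖⇒↔)
open import Relation.Binary.Definitions using (DecidableEquality)
open import Relation.Binary.PropositionalEquality
  using (refl; sym; trans; cong; cong₂; module ≡-Reasoning)
open import Relation.Nullary using (¬_; yes; no; does)

open import Algebra.Properties.CommutativeSemigroup +-commutativeSemigroup
  using () renaming (interchange to +-interchange)
open import Algebra.Properties.CommutativeSemigroup
  (CommutativeRing.+-commutativeSemigroup xor-∧-commutativeRing)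
  using () renaming (interchange to xor-interchange)

open ≡-Reasoning

module _ {A : Set} where

  sumL-cong : ∀ {f g : A → ℤ} (L : List A) → (∀ x → f x ≡ g x) → sumL f L ≡ sumL g L
  sumL-cong []      f≗g = refl
  sumL-cong (x ∷ L) f≗g = cong₂ _+_ (f≗g x) (sumL-cong L f≗g)

  sumL-0 : ∀ (L : List A) → sumL (λ _ → 0ℤ) L ≡ 0ℤ
  sumL-0 []      = refl
  sumL-0 (x ∷ L) = trans (+-identityˡ _) (sumL-0 L)

  sumL-+ : ∀ (f g : A → ℤ) (L : List A) →
           sumL (λ x → f x + g x) L ≡ sumL f L + sumL g L
  sumL-+ f g []      = refl
  sumL-+ f g (x ∷ L) =
    trans (cong (_+_ (f x + g x)) (sumL-+ f g L)) (+-interchange (f x) (g x) _ _)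

  sumL-*ʳ : ∀ c (f : A → ℤ) (L : List A) → sumL (λ x → f x * c) L ≡ sumL f L * c
  sumL-*ʳ c f []      = refl
  sumL-*ʳ c f (x ∷ L) =
    trans (cong (_+_ (f x * c)) (sumL-*ʳ c f L)) (sym (*-distribʳ-+ c (f x) _))

  sumL-neg : ∀ (f : A → ℤ) (L : List A) → sumL (λ x → - f x) L ≡ - sumL f L
  sumL-neg f []      = refl
  sumL-neg f (x ∷ L) =
    trans (cong (_+_ (- f x)) (sumL-neg f L)) (sym (neg-distrib-+ (f x) _))

  sumL-++ : ∀ (f : A → ℤ) (L L′ : List A) → sumL f (L ++ L′) ≡ sumL f L + sumL f L′
  sumL-++ f []      L′ = sym (+-identityˡ _)
  sumL-++ f (x ∷ L) L′ = trans (cong (_+_ (f x)) (sumL-++ f L L′)) (sym (+-assoc (f x) _ _))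

sumL-map : ∀ {A B : Set} (f : B → ℤ) (g : A → B) (L : List A) →
           sumL f (map g L) ≡ sumL (f ∘ g) L
sumL-map f g []      = refl
sumL-map f g (x ∷ L) = cong (_+_ (f (g x))) (sumL-map f g L)

sumL-swap : ∀ {A B : Set} (F : A → B → ℤ) (L : List A) (L′ : List B) →
            sumL (λ x → sumL (F x) L′) L ≡ sumL (λ y → sumL (λ x → F x y) L) L′
sumL-swap F []      L′ = sym (sumL-0 L′)
sumL-swap F (x ∷ L) L′ =
  trans (cong (_+_ (sumL (F x) L′)) (sumL-swap F L L′))
        (sym (sumL-+ (F x) (λ y → sumL (λ x′ → F x′ y) L) L′))

sumBits : ∀ {n} → (Bits n → ℤ) → ℤ
sumBits {n} f = sumL f (allBits n)

sumBits-suc : ∀ {n} (f : Bits (ℕ.suc n) → ℤ) →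
              sumBits f ≡ sumBits (λ x → f (false ∷ x)) + sumBits (λ x → f (true ∷ x))
sumBits-suc {n} f =
  trans (sumL-++ f (map (false ∷_) (allBits n)) _)
        (cong₂ _+_ (sumL-map f (false ∷_) (allBits n)) (sumL-map f (true ∷_) (allBits n)))

sumBits-1 : ∀ n → sumBits {n} (λ _ → 1ℤ) ≡ + (2 ^ n)
sumBits-1 ℕ.zero    = refl
sumBits-1 (ℕ.suc n) = begin
  sumBits {ℕ.suc n} (λ _ → 1ℤ)
    ≡⟨ sumBits-suc {n} (λ _ → 1ℤ) ⟩
  sumBits {n} (λ _ → 1ℤ) + sumBits {n} (λ _ → 1ℤ)
    ≡⟨ cong₂ _+_ (sumBits-1 n) (sumBits-1 n) ⟩
  + (2 ^ n ℕ.+ 2 ^ n)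
    ≡⟨ cong (λ k → + (2 ^ n ℕ.+ k)) (sym (ℕ.+-identityʳ (2 ^ n))) ⟩
  + (2 ^ ℕ.suc n) ∎

_≟ᴮ_ : ∀ {n} → DecidableEquality (Bits n)
_≟ᴮ_ = ≡-dec _≟ᵇ_

δ : ∀ {n} → Bits n → Bits n → ℤ
δ x y = if does (x ≟ᴮ y) then 1ℤ else 0ℤ

sumBits-δ : ∀ {n} (z : Bits n) → sumBits (λ x → δ x z) ≡ 1ℤ
sumBits-δ {ℕ.zero}  []          = refl
sumBits-δ {ℕ.suc n} (false ∷ z) =
  trans (sumBits-suc (λ x → δ x (false ∷ z))) (cong₂ _+_ (sumBits-δ z) (sumL-0 (allBits n)))
sumBits-δ {ℕ.suc n} (true ∷ z)  =
  trans (sumBits-suc (λ x → δ x (true ∷ z))) (cong₂ _+_ (sumL-0 (allBits n)) (sumBits-δ z))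

sumBits-δ-* : ∀ {n} (z : Bits n) (f : Bits n → ℤ) → sumBits (λ x → δ x z * f x) ≡ f z
sumBits-δ-* {n} z f = begin
  sumBits (λ x → δ x z * f x)  ≡⟨ sumL-cong (allBits n) δ-* ⟩
  sumBits (λ x → δ x z * f z)  ≡⟨ sumL-*ʳ (f z) (λ x → δ x z) (allBits n) ⟩
  sumBits (λ x → δ x z) * f z  ≡⟨ cong (_* f z) (sumBits-δ z) ⟩
  1ℤ * f z                     ≡⟨ *-identityˡ (f z) ⟩
  f z                          ∎
  where
  δ-* : ∀ x → δ x z * f x ≡ δ x z * f z
  δ-* x with x ≟ᴮ z
  ... | yes refl = refl
  ... | no  _    = refl

sumBits-∘-inverse : ∀ {n} (g g⁻¹ : Bits n → Bits n) →
                    (∀ y → g (g⁻¹ y) ≡ y) → (∀ x → g⁻¹ (g x) ≡ x) →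
                    ∀ (f : Bits n → ℤ) → sumBits (f ∘ g) ≡ sumBits f
sumBits-∘-inverse {n} g g⁻¹ gg⁻¹ g⁻¹g f = begin
  sumBits (f ∘ g)
    ≡⟨ sumL-cong A (λ x → sym (sumBits-δ-* (g x) f)) ⟩
  sumBits (λ x → sumBits (λ y → δ y (g x) * f y))
    ≡⟨ sumL-swap (λ x y → δ y (g x) * f y) A A ⟩
  sumBits (λ y → sumBits (λ x → δ y (g x) * f y))
    ≡⟨ sumL-cong A (λ y → sumL-*ʳ (f y) (λ x → δ y (g x)) A) ⟩
  sumBits (λ y → sumBits (λ x → δ y (g x)) * f y)
    ≡⟨ sumL-cong A (λ y → cong (_* f y) (sum-δ-g y)) ⟩
  sumBits (λ y → 1ℤ * f y)
    ≡⟨ sumL-cong A (λ y → *-identityˡ (f y)) ⟩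
  sumBits f ∎
  where
  A = allBits n

  δ-g : ∀ y x → δ y (g x) ≡ δ x (g⁻¹ y)
  δ-g y x with y ≟ᴮ g x | x ≟ᴮ g⁻¹ y
  ... | yes _    | yes _   = refl
  ... | no  _    | no  _   = refl
  ... | yes refl | no  x≢  = ⊥-elim (x≢ (sym (g⁻¹g x)))
  ... | no  y≢   | yes refl = ⊥-elim (y≢ (sym (gg⁻¹ y)))

  sum-δ-g : ∀ y → sumBits (λ x → δ y (g x)) ≡ 1ℤ
  sum-δ-g y = trans (sumL-cong A (δ-g y)) (sumBits-δ (g⁻¹ y))

sumBits-∘-bijective : ∀ {n} {g : Bits n → Bits n} → Bijective _≡_ _≡_ g →
                      ∀ (f : Bits n → ℤ) → sumBits (f ∘ g) ≡ sumBits f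
sumBits-∘-bijective {g = g} g-bij =
  sumBits-∘-inverse g from strictlyInverseˡ strictlyInverseʳ
  where open Inverse (⤖⇒↔ (mk⤖ g-bij))

⊕-self : ∀ {n} (x : Bits n) → x ⊕ x ≡ 𝟘
⊕-self []      = refl
⊕-self (b ∷ x) = cong₂ _∷_ (xor-same b) (⊕-self x)

⊕-involutive : ∀ {n} (x c : Bits n) → (x ⊕ c) ⊕ c ≡ x
⊕-involutive x c = begin
  (x ⊕ c) ⊕ c  ≡⟨ zipWith-assoc xor-assoc x c c ⟩
  x ⊕ (c ⊕ c)  ≡⟨ cong (x ⊕_) (⊕-self c) ⟩
  x ⊕ 𝟘        ≡⟨ zipWith-identityʳ xor-identityʳ x ⟩
  x            ∎

IsAdditive : ∀ {n} → (Bits n → Bool) → Set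
IsAdditive φ = ∀ x y → φ (x ⊕ y) ≡ φ x xor φ y

·-additive : ∀ {n} (v : Bits n) → IsAdditive (v ·_)
·-additive []          []      []      = refl
·-additive (false ∷ v) (a ∷ x) (b ∷ y) = ·-additive v x y
·-additive (true  ∷ v) (a ∷ x) (b ∷ y) =
  trans (cong ((a xor b) xor_) (·-additive v x y)) (xor-interchange a b _ _)

additive-𝟘 : ∀ {n} (φ : Bits n → Bool) → IsAdditive φ → φ 𝟘 ≡ false
additive-𝟘 φ φ-additive = begin
  φ 𝟘           ≡⟨ cong φ (sym (⊕-self 𝟘)) ⟩
  φ (𝟘 ⊕ 𝟘)     ≡⟨ φ-additive 𝟘 𝟘 ⟩
  φ 𝟘 xor φ 𝟘   ≡⟨ xor-same (φ 𝟘) ⟩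
  false         ∎

additive-∘ : ∀ {m t} {φ : Bits t → Bool} {g : Bits m → Bits t} →
             IsAdditive φ → IsF2Linear g → IsAdditive (φ ∘ g)
additive-∘ {φ = φ} {g} φ-additive g-linear x y =
  trans (cong φ (g-linear x y)) (φ-additive (g x) (g y))

additive-xor : ∀ {n} {φ ψ : Bits n → Bool} →
               IsAdditive φ → IsAdditive ψ → IsAdditive (λ x → φ x xor ψ x)
additive-xor {φ = φ} {ψ} φ-additive ψ-additive x y =
  trans (cong₂ _xor_ (φ-additive x y) (ψ-additive x y)) (xor-interchange (φ x) (φ y) (ψ x) (ψ y))

·-𝟘 : ∀ {n} (v : Bits n) → v · 𝟘 ≡ false
·-𝟘 v = additive-𝟘 (v ·_) (·-additive v)

·-nonzero : ∀ {n} (v : Bits n) → ¬ (v ≡ 𝟘) → ∃ λ u → v · u ≡ true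
·-nonzero []          v≢𝟘 = ⊥-elim (v≢𝟘 refl)
·-nonzero (true  ∷ v) _   = true ∷ 𝟘 , cong (true xor_) (·-𝟘 v)
·-nonzero (false ∷ v) v≢𝟘 with ·-nonzero v (v≢𝟘 ∘ cong (false ∷_))
... | u , v·u≡true = false ∷ u , v·u≡true

·-∘-surjective-nonzero : ∀ {m t} {τ : Bits m → Bits t} → Surjective _≡_ _≡_ τ →
                         ∀ {v} → ¬ (v ≡ 𝟘) → ∃ λ z → v · τ z ≡ true
·-∘-surjective-nonzero τ-surj {v} v≢𝟘 with ·-nonzero v v≢𝟘
... | u , v·u≡true with τ-surj u
...   | z , τz≡u = z , trans (cong (v ·_) (τz≡u refl)) v·u≡true

some-true⊎all-false : ∀ {n} (φ : Bits n → Bool) →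
                      (∃ λ x → φ x ≡ true) ⊎ (∀ x → φ x ≡ false)
some-true⊎all-false {ℕ.zero} φ with φ [] in φ[]
... | true  = inj₁ ([] , φ[])
... | false = inj₂ λ { [] → φ[] }
some-true⊎all-false {ℕ.suc n} φ
  with some-true⊎all-false (λ x → φ (false ∷ x)) | some-true⊎all-false (λ x → φ (true ∷ x))
... | inj₁ (x , φx) | _             = inj₁ (false ∷ x , φx)
... | inj₂ _        | inj₁ (x , φx) = inj₁ (true ∷ x , φx)
... | inj₂ φ₀       | inj₂ φ₁       = inj₂ λ { (false ∷ x) → φ₀ x ; (true ∷ x) → φ₁ x }

sgn-xor : ∀ a b → sgn (a xor b) ≡ sgn a * sgn b
sgn-xor false false = refl
sgn-xor false true  = refl
sgn-xor true  false = refl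
sgn-xor true  true  = refl

sgn-xor-true : ∀ b → sgn (b xor true) ≡ - sgn b
sgn-xor-true false = refl
sgn-xor-true true  = refl

i≡-i⇒i≡0 : ∀ {i} → i ≡ - i → i ≡ 0ℤ
i≡-i⇒i≡0 {+ ℕ.zero} _ = refl

sumSgn : ∀ {n} → (Bits n → Bool) → ℤ
sumSgn φ = sumBits (sgn ∘ φ)

-- Translating by x₀ flips the sign of every term, so the sum is its own negative.
sumSgn-additive-true : ∀ {n} (φ : Bits n → Bool) {x₀} →
                       IsAdditive φ → φ x₀ ≡ true → sumSgn φ ≡ 0ℤ
sumSgn-additive-true {n} φ {x₀} φ-additive φx₀ = i≡-i⇒i≡0 (begin
  sumSgn φ                          ≡⟨ sym (sumBits-∘-inverse (_⊕ x₀) (_⊕ x₀) inv inv (sgn ∘ φ)) ⟩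
  sumBits (λ x → sgn (φ (x ⊕ x₀)))  ≡⟨ sumL-cong (allBits n) sign-flip ⟩
  sumBits (λ x → - sgn (φ x))       ≡⟨ sumL-neg (sgn ∘ φ) (allBits n) ⟩
  - sumSgn φ                        ∎)
  where
  inv : ∀ x → (x ⊕ x₀) ⊕ x₀ ≡ x
  inv x = ⊕-involutive x x₀

  sign-flip : ∀ x → sgn (φ (x ⊕ x₀)) ≡ - sgn (φ x)
  sign-flip x = trans (cong sgn (trans (φ-additive x x₀) (cong (φ x xor_) φx₀)))
                      (sgn-xor-true (φ x))

sumSgn-all-false : ∀ {n} (φ : Bits n → Bool) → (∀ x → φ x ≡ false) → sumSgn φ ≡ + (2 ^ n)
sumSgn-all-false {n} φ φ≡false = trans (sumL-cong (allBits n) (cong sgn ∘ φ≡false)) (sumBits-1 n)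

sumSgn-additive : ∀ {n} (φ : Bits n → Bool) → IsAdditive φ →
                  sumSgn φ ≡ 0ℤ ⊎ sumSgn φ ≡ + (2 ^ n)
sumSgn-additive φ φ-additive with some-true⊎all-false φ
... | inj₁ (_ , φx₀) = inj₁ (sumSgn-additive-true φ φ-additive φx₀)
... | inj₂ φ≡false   = inj₂ (sumSgn-all-false φ φ≡false)

infix 4 _≡±_

_≡±_ : ℤ → ℤ → Set
i ≡± j = i ≡ j ⊎ i ≡ - j

≡±-transˡ : ∀ {i j k} → i ≡ j → j ≡± k → i ≡± k
≡±-transˡ i≡j = map-⊎ (trans i≡j) (trans i≡j)

sumL-nonneg : ∀ {A : Set} {w : A → ℤ} → (∀ a → ∃ λ i → w a ≡ + i) →
              ∀ L → ∃ λ j → sumL w L ≡ + j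
sumL-nonneg w≥0 []      = 0 , refl
sumL-nonneg w≥0 (a ∷ L) with w≥0 a | sumL-nonneg w≥0 L
... | i , wa≡i | j , Σ≡j = i ℕ.+ j , cong₂ _+_ wa≡i Σ≡j

module _ {A : Set} (w : A → ℤ) (s : A → Bool) where

  signedSum : List A → ℤ
  signedSum = sumL (λ a → w a * sgn (s a))

  signedSum-nonneg-0 : (∀ a → ∃ λ i → w a ≡ + i) →
                       ∀ L → sumL w L ≡ 0ℤ → signedSum L ≡ 0ℤ
  signedSum-nonneg-0 w≥0 []      _   = refl
  signedSum-nonneg-0 w≥0 (a ∷ L) Σ≡0 with w≥0 a | sumL-nonneg w≥0 L
  ... | i , wa≡i | j , Σ≡j = cong₂ _+_ head≡0 (signedSum-nonneg-0 w≥0 L (trans Σ≡j (cong +_ j≡0)))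
    where
    i+j≡0 : i ℕ.+ j ≡ 0
    i+j≡0 = +-injective (trans (sym (cong₂ _+_ wa≡i Σ≡j)) Σ≡0)

    j≡0 : j ≡ 0
    j≡0 = ℕ.m+n≡0⇒n≡0 i i+j≡0

    head≡0 : w a * sgn (s a) ≡ 0ℤ
    head≡0 = cong (_* sgn (s a)) (trans wa≡i (cong +_ (ℕ.m+n≡0⇒m≡0 i i+j≡0)))

  signedSum-≡± : ∀ {n} → (∀ a → w a ≡ 0ℤ ⊎ w a ≡ + n) →
                 ∀ L → sumL w L ≡ + n → signedSum L ≡± + n
  signedSum-≡± {n} w∈ [] Σ≡n = inj₁ Σ≡n
  signedSum-≡± {n} w∈ (a ∷ L) Σ≡n with w∈ a
  ... | inj₁ wa≡0 = ≡±-transˡ head-vanishes (signedSum-≡± w∈ L tail≡n)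
    where
    tail≡n : sumL w L ≡ + n
    tail≡n = trans (sym (trans (cong (_+ sumL w L) wa≡0) (+-identityˡ _))) Σ≡n

    head-vanishes : signedSum (a ∷ L) ≡ signedSum L
    head-vanishes = trans (cong (λ k → k * sgn (s a) + signedSum L) wa≡0)
                          (+-identityˡ _)
  ... | inj₂ wa≡n = ≡±-transˡ tail-vanishes (n*sgn (s a))
    where
    w≥0 : ∀ a → ∃ λ i → w a ≡ + i
    w≥0 a = [ (λ wa≡0 → 0 , wa≡0) , (λ wa≡n → n , wa≡n) ]′ (w∈ a)

    tail≡0 : sumL w L ≡ 0ℤ
    tail≡0 with sumL-nonneg w≥0 L
    ... | j , Σ≡j = trans Σ≡j (cong +_ (ℕ.+-cancelˡ-≡ n j 0
      (trans (+-injective (trans (sym (cong₂ _+_ wa≡n Σ≡j)) Σ≡n)) (sym (ℕ.+-identityʳ n)))))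

    tail-vanishes : signedSum (a ∷ L) ≡ + n * sgn (s a)
    tail-vanishes = trans (cong₂ _+_ (cong (_* sgn (s a)) wa≡n) (signedSum-nonneg-0 w≥0 L tail≡0))
                          (+-identityʳ _)

    n*sgn : ∀ b → + n * sgn b ≡± + n
    n*sgn false = inj₁ (*-identityʳ (+ n))
    n*sgn true  = inj₂ (trans (*-comm (+ n) -1ℤ) (-1*i≡-i (+ n)))

walshᵇ : ∀ {m} → (Bits m → Bits m → Bool) → Bits m → Bits m → ℤ
walshᵇ f a₁ a₂ = sumBits (λ x → sumBits (λ y → sgn (f x y xor (a₁ · x) xor (a₂ · y))))

IsBentᵇ : ∀ {m} → (Bits m → Bits m → Bool) → Set
IsBentᵇ {m} f = ∀ a₁ a₂ → walshᵇ f a₁ a₂ ≡± + (2 ^ m)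

walshᵇ-cong : ∀ {m} {f g : Bits m → Bits m → Bool} → (∀ x y → f x y ≡ g x y) →
              ∀ a₁ a₂ → walshᵇ f a₁ a₂ ≡ walshᵇ g a₁ a₂
walshᵇ-cong {m} f≗g a₁ a₂ = sumL-cong (allBits m) λ x → sumL-cong (allBits m) λ y →
  cong (λ b → sgn (b xor (a₁ · x) xor (a₂ · y))) (f≗g x y)

module _ {m} {_⋆_ : Bits m → Bits m → Bits m} (Q : IsLeftPreQuasifield _⋆_)
         (φ : Bits m → Bool) (φ-additive : IsAdditive φ) {z₀ : Bits m} (φz₀ : φ z₀ ≡ true) where

  open IsLeftPreQuasifield Q

  sumSgn-⋆ʳ : ∀ x → sumSgn (λ b → φ (b ⋆ x)) ≡ δ x 𝟘 * + (2 ^ m)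
  sumSgn-⋆ʳ x with x ≟ᴮ 𝟘
  ... | yes refl = begin
    sumSgn (λ b → φ (b ⋆ 𝟘))  ≡⟨ sumL-cong (allBits m) (λ b → cong sgn φb⋆𝟘≡false) ⟩
    sumBits {m} (λ _ → 1ℤ)    ≡⟨ sumBits-1 m ⟩
    + (2 ^ m)                 ≡⟨ sym (*-identityˡ _) ⟩
    1ℤ * + (2 ^ m)            ∎
    where
    φb⋆𝟘≡false : ∀ {b} → φ (b ⋆ 𝟘) ≡ false
    φb⋆𝟘≡false {b} = trans (cong φ (zeroʳ b)) (additive-𝟘 φ φ-additive)
  ... | no x≢𝟘 =
    trans (sumBits-∘-bijective (bijʳ x x≢𝟘) (sgn ∘ φ)) (sumSgn-additive-true φ φ-additive φz₀)

  module _ (a₁ : Bits m) where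

    ψ : Bits m → Bits m → Bool
    ψ b x = φ (b ⋆ x) xor (a₁ · x)

    sumSgn-ψ : ∀ b → sumSgn (ψ b) ≡ 0ℤ ⊎ sumSgn (ψ b) ≡ + (2 ^ m)
    sumSgn-ψ b = sumSgn-additive (ψ b)
      (additive-xor {φ = φ ∘ (b ⋆_)}
        (additive-∘ {φ = φ} φ-additive (distribˡ b)) (·-additive a₁))

    sumBits-sumSgn-ψ : sumBits (λ b → sumSgn (ψ b)) ≡ + (2 ^ m)
    sumBits-sumSgn-ψ = begin
      sumBits (λ b → sumSgn (ψ b))
        ≡⟨ sumL-cong A (λ b → sumL-cong A (λ x → sgn-xor (φ (b ⋆ x)) (a₁ · x))) ⟩
      sumBits (λ b → sumBits (λ x → sgn (φ (b ⋆ x)) * sgn (a₁ · x)))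
        ≡⟨ sumL-swap (λ b x → sgn (φ (b ⋆ x)) * sgn (a₁ · x)) A A ⟩
      sumBits (λ x → sumBits (λ b → sgn (φ (b ⋆ x)) * sgn (a₁ · x)))
        ≡⟨ sumL-cong A (λ x → sumL-*ʳ (sgn (a₁ · x)) (λ b → sgn (φ (b ⋆ x))) A) ⟩
      sumBits (λ x → sumSgn (λ b → φ (b ⋆ x)) * sgn (a₁ · x))
        ≡⟨ sumL-cong A (λ x → trans (cong (_* sgn (a₁ · x)) (sumSgn-⋆ʳ x))
                                    (*-assoc (δ x 𝟘) _ _)) ⟩
      sumBits (λ x → δ x 𝟘 * (+ (2 ^ m) * sgn (a₁ · x)))
        ≡⟨ sumBits-δ-* 𝟘 (λ x → + (2 ^ m) * sgn (a₁ · x)) ⟩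
      + (2 ^ m) * sgn (a₁ · 𝟘)
        ≡⟨ cong (λ b → + (2 ^ m) * sgn b) (·-𝟘 a₁) ⟩
      + (2 ^ m) * 1ℤ
        ≡⟨ *-identityʳ _ ⟩
      + (2 ^ m) ∎
      where A = allBits m

  bentᵇ-⋆ : ∀ {σ : Bits m → Bits m} → Bijective _≡_ _≡_ σ → ∀ (c : Bits m → Bool) →
            IsBentᵇ (λ x y → φ (σ y ⋆ x) xor c y)
  bentᵇ-⋆ {σ} σ-bij c a₁ a₂ =
    ≡±-transˡ walsh≡ (signedSum-≡± Z s Z∈ A ΣZ≡2^m)
    where
    A = allBits m

    Z : Bits m → ℤ
    Z y = sumSgn (ψ a₁ (σ y))

    s : Bits m → Bool
    s y = c y xor (a₂ · y)

    Z∈ : ∀ y → Z y ≡ 0ℤ ⊎ Z y ≡ + (2 ^ m)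
    Z∈ y = sumSgn-ψ a₁ (σ y)

    ΣZ≡2^m : sumBits Z ≡ + (2 ^ m)
    ΣZ≡2^m = trans (sumBits-∘-bijective σ-bij (λ b → sumSgn (ψ a₁ b))) (sumBits-sumSgn-ψ a₁)

    split : ∀ x y → sgn ((φ (σ y ⋆ x) xor c y) xor (a₁ · x) xor (a₂ · y))
                  ≡ sgn (ψ a₁ (σ y) x) * sgn (s y)
    split x y = trans (cong sgn (xor-interchange (φ (σ y ⋆ x)) (c y) (a₁ · x) (a₂ · y)))
                      (sgn-xor (ψ a₁ (σ y) x) (s y))

    walsh≡ : walshᵇ (λ x y → φ (σ y ⋆ x) xor c y) a₁ a₂ ≡ signedSum Z s A
    walsh≡ = begin
      walshᵇ (λ x y → φ (σ y ⋆ x) xor c y) a₁ a₂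
        ≡⟨ sumL-cong A (λ x → sumL-cong A (split x)) ⟩
      sumBits (λ x → sumBits (λ y → sgn (ψ a₁ (σ y) x) * sgn (s y)))
        ≡⟨ sumL-swap (λ x y → sgn (ψ a₁ (σ y) x) * sgn (s y)) A A ⟩
      sumBits (λ y → sumBits (λ x → sgn (ψ a₁ (σ y) x) * sgn (s y)))
        ≡⟨ sumL-cong A (λ y → sumL-*ʳ (sgn (s y)) (sgn ∘ ψ a₁ (σ y)) A) ⟩
      signedSum Z s A ∎

theorem4 : (m t : ℕ) → 1 ≤ t → t ≤ m →
    (_⋆_ : Bits m → Bits m → Bits m) → IsLeftPreQuasifield _⋆_ →
    (τ : Bits m → Bits t) → Surjective _≡_ _≡_ τ → IsF2Linear τ →
    (σ : Bits m → Bits m) → Bijective _≡_ _≡_ σ →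
    (h : Bits m → Bits t) →
    IsBent (λ x y → τ (σ y ⋆ x) ⊕ h y)
theorem4 m t _ _ _⋆_ Q τ τ-surj τ-linear σ σ-bij h v v≢𝟘 a₁ a₂ =
  ≡±-transˡ walsh≡ (bentᵇ-⋆ Q φ φ-additive φ-nonzero σ-bij ((v ·_) ∘ h) a₁ a₂)
  where
  φ : Bits m → Bool
  φ = (v ·_) ∘ τ

  φ-additive : IsAdditive φ
  φ-additive = additive-∘ {φ = v ·_} (·-additive v) τ-linear

  φ-nonzero : φ (proj₁ (·-∘-surjective-nonzero τ-surj v≢𝟘)) ≡ true
  φ-nonzero = proj₂ (·-∘-surjective-nonzero τ-surj v≢𝟘)

  walsh≡ : walsh (λ x y → τ (σ y ⋆ x) ⊕ h y) v a₁ a₂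
         ≡ walshᵇ (λ x y → φ (σ y ⋆ x) xor v · h y) a₁ a₂
  walsh≡ = walshᵇ-cong (λ x y → ·-additive v (τ (σ y ⋆ x)) (h y)) a₁ a₂
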